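{- Let $T:\mathcal C\to\mathcal A$ be a covariant functor satisfying (Ax0), (Ax2) and (Ax3), and let $T_{\max}$ be the restriction of $T$ to $\mathrm{Max}(\mathcal C)$. Then $T_{\max}$ is conservative: a morphism $f$ of $\mathrm{Max}(\mathcal C)$ is an isomorphism if and only if $T_{\max}(f)$ is one. Moreover, if $T$ is faithful (resp. full, resp. essentially surjective), then so is $T_{\max}$.
   Context: For $A\in\mathcal A$, the fibre $\mathcal F_A$ is the category whose objects are pairs $(C,f)$ with $C\in\mathcal C$ and $f:T(C)\to A$ an isomorphism, a morphism $(C,f)\to(C',f')$ being a morphism $g:C\to C'$ with $f=f'\circ T(g)$. Axioms: (Ax0) for every $C\in\mathcal C$ and every isomorphism $f:T(C)\to A'$ in $\mathcal A$ there is an isomorphism $g:C\to C'$ in $\mathcal C$ with $T(g)=f$; (Ax2) $\mathcal C$ and $\mathcal A$ admit pushouts and $T$ preserves them; (Ax3) for every $A$, $\mathcal F_A$ is either empty or has a final object. $\mathrm{Max}(\mathcal C)$ is the full subcategory of $\mathcal C$ whose objects are those $C$ for which $(C,\mathrm{id}_{T(C)})$ is a final object of $\mathcal F_{T(C)}$. -}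

module Defs where

open import Level using (Level; _⊔_; suc)
open import Data.Product using (Σ; Σ-syntax; _×_; _,_; proj₁; proj₂)
open import Data.Sum using (_⊎_)
open import Relation.Nullary using (¬_)
open import Relation.Binary.PropositionalEquality using (_≡_; subst; refl; sym; trans; cong; cong₂)
open import Function.Bundles using (_⇔_)

record Category (o ℓ : Level) : Set (suc (o ⊔ ℓ)) where
  infixr 9 _∘_
  field
    Obj : Set o
    Hom : Obj → Obj → Set ℓ
    id  : ∀ {X} → Hom X X
    _∘_ : ∀ {X Y Z} → Hom Y Z → Hom X Y → Hom X Z
    identityˡ : ∀ {X Y} (f : Hom X Y) → id ∘ f ≡ f
    identityʳ : ∀ {X Y} (f : Hom X Y) → f ∘ id ≡ f
    assoc : ∀ {W X Y Z} (h : Hom Y Z) (g : Hom X Y) (f : Hom W X) →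
            (h ∘ g) ∘ f ≡ h ∘ (g ∘ f)

  IsIso : ∀ {X Y} → Hom X Y → Set ℓ
  IsIso {X} {Y} f = Σ[ g ∈ Hom Y X ] ((g ∘ f ≡ id) × (f ∘ g ≡ id))

  Iso : Obj → Obj → Set ℓ
  Iso X Y = Σ[ f ∈ Hom X Y ] IsIso f

  IsPushout : ∀ {X Y Z P} (f : Hom X Y) (g : Hom X Z) (i₁ : Hom Y P) (i₂ : Hom Z P) →
              Set (o ⊔ ℓ)
  IsPushout {X} {Y} {Z} {P} f g i₁ i₂ =
    (i₁ ∘ f ≡ i₂ ∘ g) ×
    (∀ {Q} (h₁ : Hom Y Q) (h₂ : Hom Z Q) → h₁ ∘ f ≡ h₂ ∘ g →
      Σ[ u ∈ Hom P Q ] (((u ∘ i₁ ≡ h₁) × (u ∘ i₂ ≡ h₂)) ×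
        (∀ (u' : Hom P Q) → u' ∘ i₁ ≡ h₁ → u' ∘ i₂ ≡ h₂ → u' ≡ u)))

  HasPushouts : Set (o ⊔ ℓ)
  HasPushouts = ∀ {X Y Z} (f : Hom X Y) (g : Hom X Z) →
    Σ[ P ∈ Obj ] Σ[ i₁ ∈ Hom Y P ] Σ[ i₂ ∈ Hom Z P ] IsPushout f g i₁ i₂

record Functor {o ℓ o' ℓ'} (C : Category o ℓ) (D : Category o' ℓ') : Set (o ⊔ ℓ ⊔ o' ⊔ ℓ') where
  private
    module C = Category C
    module D = Category D
  field
    F₀ : C.Obj → D.Obj
    F₁ : ∀ {X Y} → C.Hom X Y → D.Hom (F₀ X) (F₀ Y)
    F-id : ∀ {X} → F₁ (C.id {X}) ≡ D.id
    F-∘ : ∀ {X Y Z} (g : C.Hom Y Z) (f : C.Hom X Y) → F₁ (g C.∘ f) ≡ F₁ g D.∘ F₁ f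

module _ {o ℓ o' ℓ'} {C : Category o ℓ} {D : Category o' ℓ'} (F : Functor C D) where
  private
    module C = Category C
    module D = Category D
  open Functor F

  Conservative : Set (o ⊔ ℓ ⊔ ℓ')
  Conservative = ∀ {X Y} (f : C.Hom X Y) → C.IsIso f ⇔ D.IsIso (F₁ f)

  Faithful : Set (o ⊔ ℓ ⊔ ℓ')
  Faithful = ∀ {X Y} (f g : C.Hom X Y) → F₁ f ≡ F₁ g → f ≡ g

  Full : Set (o ⊔ ℓ ⊔ ℓ')
  Full = ∀ {X Y} (h : D.Hom (F₀ X) (F₀ Y)) → Σ[ f ∈ C.Hom X Y ] F₁ f ≡ h

  EssentiallySurjective : Set (o ⊔ o' ⊔ ℓ')
  EssentiallySurjective = ∀ (A : D.Obj) → Σ[ X ∈ C.Obj ] D.Iso (F₀ X) A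

  PreservesPushouts : Set (o ⊔ ℓ ⊔ ℓ' ⊔ o')
  PreservesPushouts = ∀ {X Y Z P} (f : C.Hom X Y) (g : C.Hom X Z)
    (i₁ : C.Hom Y P) (i₂ : C.Hom Z P) →
    C.IsPushout f g i₁ i₂ → D.IsPushout (F₁ f) (F₁ g) (F₁ i₁) (F₁ i₂)

  FibreObj : D.Obj → Set (o ⊔ ℓ')
  FibreObj A = Σ[ X ∈ C.Obj ] Σ[ f ∈ D.Hom (F₀ X) A ] D.IsIso f

  FibreHom : ∀ {A} → FibreObj A → FibreObj A → Set (ℓ ⊔ ℓ')
  FibreHom (X , f , _) (X' , f' , _) = Σ[ g ∈ C.Hom X X' ] f ≡ f' D.∘ F₁ g

  IsFinalInFibre : ∀ {A} → FibreObj A → Set (o ⊔ ℓ ⊔ ℓ')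
  IsFinalInFibre {A} t = ∀ (s : FibreObj A) →
    Σ[ u ∈ FibreHom s t ] (∀ (v : FibreHom s t) → proj₁ v ≡ proj₁ u)

  Ax0 : Set (o ⊔ ℓ ⊔ o' ⊔ ℓ')
  Ax0 = ∀ (X : C.Obj) {A' : D.Obj} (f : D.Hom (F₀ X) A') → D.IsIso f →
    Σ[ X' ∈ C.Obj ] Σ[ g ∈ C.Hom X X' ] (C.IsIso g ×
      Σ[ e ∈ F₀ X' ≡ A' ] subst (D.Hom (F₀ X)) e (F₁ g) ≡ f)

  Ax2 : Set (o ⊔ ℓ ⊔ o' ⊔ ℓ')
  Ax2 = C.HasPushouts × D.HasPushouts × PreservesPushouts

  Ax3 : Set (o ⊔ ℓ ⊔ o' ⊔ ℓ')
  Ax3 = ∀ (A : D.Obj) → (¬ FibreObj A) ⊎ (Σ[ t ∈ FibreObj A ] IsFinalInFibre t)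

  IsMax : C.Obj → Set (o ⊔ ℓ ⊔ ℓ')
  IsMax X = IsFinalInFibre {F₀ X} (X , D.id , D.id , D.identityˡ D.id , D.identityˡ D.id)

  MaxCat : Category (o ⊔ ℓ ⊔ ℓ') ℓ
  MaxCat = record
    { Obj = Σ[ X ∈ C.Obj ] IsMax X
    ; Hom = λ X Y → C.Hom (proj₁ X) (proj₁ Y)
    ; id = C.id
    ; _∘_ = C._∘_
    ; identityˡ = C.identityˡ
    ; identityʳ = C.identityʳ
    ; assoc = C.assoc
    }

  Tmax : Functor MaxCat D
  Tmax = record
    { F₀ = λ X → F₀ (proj₁ X)
    ; F₁ = F₁
    ; F-id = F-id
    ; F-∘ = F-∘
    }

module Submission where

-- Finality has two halves, and each yields one general fact:
--   * existence: every isomorphism h : T Y → T X with X maximal lifts to some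
--     u : Y → X with T u = h (lift-into-max);
--   * uniqueness: two maps g h : Y → X into a maximal X with T g = T h an
--     isomorphism coincide (max-maps-determined).
-- Conservativity of T_max follows: lift an inverse of T f and check both
-- composites against the identity with the uniqueness half.  Fullness and
-- faithfulness are inherited because Max(C) is a full subcategory.  For
-- essential surjectivity, (Ax3) gives a final object (X , f) in the (nonempty)
-- fibre over A, and X is maximal: a final object of one fibre is maximal
-- (final⇒max), via transport along the isomorphism f.  Only (Ax3) is used.

open import Defs
open import Data.Product using (Σ; _×_; _,_; proj₁; proj₂)
open import Data.Sum using (inj₁; inj₂)
open import Data.Empty using (⊥-elim)
open import Function.Bundles using (mk⇔)
open import Relation.Binary.PropositionalEquality
open ≡-Reasoning

module IsoFacts {o ℓ} (𝒞 : Category o ℓ) where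
  open Category 𝒞

  iso-cancelˡ : ∀ {X Y Z} (k : Hom Y Z) → IsIso k →
                (a b : Hom X Y) → k ∘ a ≡ k ∘ b → a ≡ b
  iso-cancelˡ k (k⁻¹ , k⁻¹k , _) a b e = begin
    a                 ≡⟨ sym (identityˡ a) ⟩
    id ∘ a            ≡⟨ cong (_∘ a) (sym k⁻¹k) ⟩
    (k⁻¹ ∘ k) ∘ a     ≡⟨ assoc k⁻¹ k a ⟩
    k⁻¹ ∘ (k ∘ a)     ≡⟨ cong (k⁻¹ ∘_) e ⟩
    k⁻¹ ∘ (k ∘ b)     ≡⟨ sym (assoc k⁻¹ k b) ⟩
    (k⁻¹ ∘ k) ∘ b     ≡⟨ cong (_∘ b) k⁻¹k ⟩
    id ∘ b            ≡⟨ identityˡ b ⟩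
    b                 ∎

  private
    sandwich : ∀ {X Y Z} (k : Hom Y Z) (k' : Hom Z Y) (g : Hom X Y) (f : Hom Y X) →
               g ∘ f ≡ id → k ∘ k' ≡ id → (k ∘ g) ∘ (f ∘ k') ≡ id
    sandwich k k' g f gf kk' = begin
      (k ∘ g) ∘ (f ∘ k')  ≡⟨ assoc k g (f ∘ k') ⟩
      k ∘ (g ∘ (f ∘ k'))  ≡⟨ cong (k ∘_) (sym (assoc g f k')) ⟩
      k ∘ ((g ∘ f) ∘ k')  ≡⟨ cong (λ m → k ∘ (m ∘ k')) gf ⟩
      k ∘ (id ∘ k')       ≡⟨ cong (k ∘_) (identityˡ k') ⟩
      k ∘ k'              ≡⟨ kk' ⟩
      id                  ∎

  iso-∘ : ∀ {X Y Z} (k : Hom Y Z) (g : Hom X Y) → IsIso k → IsIso g → IsIso (k ∘ g)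
  iso-∘ k g (k⁻¹ , k⁻¹k , kk⁻¹) (g⁻¹ , g⁻¹g , gg⁻¹) =
    g⁻¹ ∘ k⁻¹ , sandwich g⁻¹ g k⁻¹ k k⁻¹k g⁻¹g , sandwich k k⁻¹ g g⁻¹ gg⁻¹ kk⁻¹

  iso-id : ∀ {X} → IsIso (id {X})
  iso-id = id , identityˡ id , identityˡ id

module MaxFacts {o ℓ o' ℓ'} {C : Category o ℓ} {A : Category o' ℓ'} (T : Functor C A) where
  private
    module C = Category C
    module A = Category A
  open Functor T
  open IsoFacts A

  F-iso : ∀ {X Y} (f : C.Hom X Y) → C.IsIso f → A.IsIso (F₁ f)
  F-iso f (g , gf , fg) = F₁ g , inverse g f gf , inverse f g fg
    where
    inverse : ∀ {X Y} (a : C.Hom Y X) (b : C.Hom X Y) →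
              a C.∘ b ≡ C.id → F₁ a A.∘ F₁ b ≡ A.id
    inverse a b ab = trans (sym (F-∘ a b)) (trans (cong F₁ ab) F-id)

  into-identity : ∀ {X Y} {h : A.Hom (F₀ Y) (F₀ X)} (g : C.Hom Y X) →
                  F₁ g ≡ h → h ≡ A.id A.∘ F₁ g
  into-identity g Tg≡h = sym (trans (A.identityˡ (F₁ g)) Tg≡h)

  lift-into-max : ∀ {X Y} → IsMax T X → (h : A.Hom (F₀ Y) (F₀ X)) → A.IsIso h →
                  Σ (C.Hom Y X) (λ u → F₁ u ≡ h)
  lift-into-max mX h h-iso with mX (_ , h , h-iso)
  ... | (u , h≡Tu) , _ = u , sym (trans h≡Tu (A.identityˡ (F₁ u)))

  max-maps-determined : ∀ {X Y} → IsMax T X → (g h : C.Hom Y X) →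
                        A.IsIso (F₁ g) → F₁ g ≡ F₁ h → g ≡ h
  max-maps-determined mX g h Tg-iso Tg≡Th with mX (_ , F₁ g , Tg-iso)
  ... | _ , unique =
    trans (unique (g , into-identity g refl)) (sym (unique (h , into-identity h (sym Tg≡Th))))

  max-conservative : Conservative (Tmax T)
  max-conservative {X , mX} {Y , mY} f = mk⇔ (F-iso f) reflect
    where
    reflect : A.IsIso (F₁ f) → C.IsIso f
    reflect (h , hTf , Tfh) = u , u∘f≡id , f∘u≡id
      where
      u : C.Hom Y X
      u = proj₁ (lift-into-max mX h (F₁ f , Tfh , hTf))

      Tu≡h : F₁ u ≡ h
      Tu≡h = proj₂ (lift-into-max mX h (F₁ f , Tfh , hTf))

      -- Both composites are endomorphisms of maximal objects mapped to id by T.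
      trivial-endo : ∀ {Z} → IsMax T Z → (e : C.Hom Z Z) → F₁ e ≡ A.id → e ≡ C.id
      trivial-endo mZ e Te≡id =
        max-maps-determined mZ e C.id (subst A.IsIso (sym Te≡id) iso-id) (trans Te≡id (sym F-id))

      u∘f≡id : u C.∘ f ≡ C.id
      u∘f≡id = trivial-endo mX (u C.∘ f) (begin
        F₁ (u C.∘ f)     ≡⟨ F-∘ u f ⟩
        F₁ u A.∘ F₁ f    ≡⟨ cong (A._∘ F₁ f) Tu≡h ⟩
        h A.∘ F₁ f       ≡⟨ hTf ⟩
        A.id             ∎)

      f∘u≡id : f C.∘ u ≡ C.id
      f∘u≡id = trivial-endo mY (f C.∘ u) (begin
        F₁ (f C.∘ u)     ≡⟨ F-∘ f u ⟩
        F₁ f A.∘ F₁ u    ≡⟨ cong (F₁ f A.∘_) Tu≡h ⟩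
        F₁ f A.∘ h       ≡⟨ Tfh ⟩
        A.id             ∎)

  -- If (X , f) is final in the fibre over B, then X is maximal: a fibre
  -- object (Z , g) over T X corresponds to (Z , f ∘ g) over B, and f is monic.
  final⇒max : ∀ {B} (X : C.Obj) (f : A.Hom (F₀ X) B) (f-iso : A.IsIso f) →
              IsFinalInFibre T (X , f , f-iso) → IsMax T X
  final⇒max X f f-iso final (Z , g , g-iso)
    with final (Z , f A.∘ g , iso-∘ f g f-iso g-iso)
  ... | (u , f∘g≡f∘Tu) , unique-over-B = (u , g≡Tu) , unique
    where
    g≡Tu : g ≡ A.id A.∘ F₁ u
    g≡Tu = trans (iso-cancelˡ f f-iso g (F₁ u) f∘g≡f∘Tu) (sym (A.identityˡ (F₁ u)))

    unique : ∀ (v : FibreHom T (Z , g , g-iso) (X , A.id , iso-id)) → proj₁ v ≡ u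
    unique (v , g≡Tv) = unique-over-B (v , cong (f A.∘_) (trans g≡Tv (A.identityˡ (F₁ v))))

  -- Under (Ax3), essential surjectivity passes from T to T_max: the fibre over
  -- any B is nonempty, so it has a final object, whose underlying object is maximal.
  max-essSurj : Ax3 T → EssentiallySurjective T → EssentiallySurjective (Tmax T)
  max-essSurj ax3 essSurj B with ax3 B
  ... | inj₁ fibre-empty = ⊥-elim (fibre-empty (proj₁ (essSurj B) , proj₂ (essSurj B)))
  ... | inj₂ ((X , f , f-iso) , final) = (X , final⇒max X f f-iso final) , f , f-iso

proposition1p2p8 : ∀ {o ℓ o' ℓ'} (C : Category o ℓ) (A : Category o' ℓ') (T : Functor C A) →
    Ax0 T → Ax2 T → Ax3 T →
    Conservative (Tmax T)
    × (Faithful T → Faithful (Tmax T))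
    × (Full T → Full (Tmax T))
    × (EssentiallySurjective T → EssentiallySurjective (Tmax T))
proposition1p2p8 C A T _ _ ax3 =
    (λ {X} {Y} → max-conservative {X} {Y})
  -- Max(C) is full in C, so hom-sets and the action of T on them are unchanged.
  , (λ faithful {X} {Y} → faithful {proj₁ X} {proj₁ Y})
  , (λ full {X} {Y} → full {proj₁ X} {proj₁ Y})
  , max-essSurj ax3
  where open MaxFacts T
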